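{- Let $H$ be a bipartite multigraph with parts $A$ and $B$, both nonempty, and let $\alpha>0$. Suppose that for every nonempty subset $B'\subseteq B$, with $A'=N(B')\subseteq A$, there exists a vertex $u\in A'$ with $d_{B'}(u)<\alpha$. Then $\alpha|A|>|B|$.
   Context: $N(B')$ is the set of vertices of $A$ adjacent to some vertex of $B'$, and $d_{B'}(u)$ is the number of edges (counted with multiplicity) between $u$ and $B'$.
   Formalization: The parameter α ranges over the positive rationals. -}

module Defs where

open import Data.Nat using (ℕ; _<_)
open import Data.Fin using (Fin)
open import Data.Fin.Subset using (Subset; _∈_)
open import Data.Vec using (tabulate; lookup)
open import Data.Vec using () renaming (sum to vsum)
open import Data.Bool using (if_then_else_)
open import Data.Product using (∃-syntax; _×_)
open import Data.Integer using (+_)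
open import Data.Rational using (ℚ; _/_)

-- A bipartite multigraph with parts A = Fin a and B = Fin b is given by
-- an edge-multiplicity function  m : Fin a → Fin b → ℕ.
Multigraph : ℕ → ℕ → Set
Multigraph a b = Fin a → Fin b → ℕ

InNbhd : ∀ {a b} → Multigraph a b → Subset b → Fin a → Set
InNbhd m B' u = ∃[ v ] (v ∈ B' × 0 < m u v)

degIn : ∀ {a b} → Multigraph a b → Subset b → Fin a → ℕ
degIn m B' u = vsum (tabulate λ v → if lookup B' v then m u v else 0)

ℕ→ℚ : ℕ → ℚ
ℕ→ℚ n = + n / 1

-- Peel off the vertices of A one at a time. If every neighbour of a nonempty S ⊆ B lies
-- in T ⊆ A, the hypothesis gives u ∈ N(S) with d_S(u) < α; the vertices of S not adjacent
-- to u have all their neighbours in T - u, and the vertices adjacent to u number at most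
-- d_S(u). Induction on |T| then gives |S| < α|T|, and S = B, T = A is the theorem.
{-# OPTIONS --safe #-}
module Submission where

open import Defs
open import Data.Nat using (ℕ; _<_)
open import Data.Fin using (Fin)
open import Data.Fin.Subset using (Subset; Nonempty)
open import Data.Product using (∃-syntax; _×_)
open import Data.Rational using (ℚ; 0ℚ; _*_) renaming (_<_ to _<ℚ_)

open import Data.Bool.Properties using (T-≡)
open import Data.Fin using (zero; suc; fromℕ<)
open import Data.Fin.Subset using (_∈_; _∉_; _─_; _-_; ∣_∣; ⊤; inside; outside)
open import Data.Fin.Subset.Properties
  using (nonempty?; Empty-unique; ∣⊥∣≡0; ∣⊤∣≡n; ∈⊤; drop-there; p─q⊆p; x∈p∧x≢y⇒x∈p-y; x∈p⇒∣p-x∣<∣p∣)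
open import Data.Integer using (+_; +≤+) renaming (_≤_ to _≤ℤ_; _+_ to _+ℤ_)
import Data.Integer.Properties as ℤ
open import Data.Nat using (zero; suc; _+_; _≤_; _<ᵇ_; z≤n; s≤s)
open import Data.Nat.Coprimality using (1-coprimeTo) renaming (sym to coprime-sym)
open import Data.Nat.Induction using (<-wellFounded)
open import Data.Nat.Properties using (<⇒<ᵇ; +-suc; +-monoʳ-≤; m≤n+m)
import Data.Nat.Properties as ℕ
open import Data.Product using (_,_)
open import Data.Rational using (mkℚ; 1ℚ; *≤*; NonNegative; positive)
  renaming (_≤_ to _≤ℚ_; _+_ to _+ℚ_)
open import Data.Rational.Properties
  using (normalize-coprime; /-cong; *-identityʳ; *-zeroʳ; *-distribˡ-+; +-mono-≤-<; <⇒≤;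
         *-monoˡ-≤-nonNeg; pos⇒nonNeg; module ≤-Reasoning)
open import Data.Vec using (_∷_; []; tabulate; here; there)
open import Data.Vec.Properties using (lookup⇒[]=; lookup∘tabulate)
open import Function using (_on_; _∘_)
open import Function.Bundles using (Equivalence)
open import Induction.WellFounded using (Acc; acc)
open import Relation.Binary.Construct.On using () renaming (wellFounded to on-wellFounded)
open import Relation.Binary.PropositionalEquality
open import Relation.Nullary using (yes; no)
open import Relation.Unary using () renaming (_⊆_ to _⊆ᵤ_)

ℕ→ℚ≡mkℚ : ∀ n → ℕ→ℚ n ≡ mkℚ (+ n) 0 (coprime-sym (1-coprimeTo n))
ℕ→ℚ≡mkℚ n = normalize-coprime (coprime-sym (1-coprimeTo n))

ℕ→ℚ-mono-≤ : ∀ {m n} → m ≤ n → ℕ→ℚ m ≤ℚ ℕ→ℚ n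
ℕ→ℚ-mono-≤ {m} {n} m≤n rewrite ℕ→ℚ≡mkℚ m | ℕ→ℚ≡mkℚ n =
  *≤* (subst₂ _≤ℤ_ (sym (ℤ.*-identityʳ (+ m))) (sym (ℤ.*-identityʳ (+ n))) (+≤+ m≤n))

ℕ→ℚ-homo-+ : ∀ m n → ℕ→ℚ (m + n) ≡ ℕ→ℚ m +ℚ ℕ→ℚ n
ℕ→ℚ-homo-+ m n rewrite ℕ→ℚ≡mkℚ m | ℕ→ℚ≡mkℚ n =
  /-cong (cong₂ _+ℤ_ (sym (ℤ.*-identityʳ (+ m))) (sym (ℤ.*-identityʳ (+ n)))) refl

*-ℕ→ℚ-suc : ∀ r n → r * ℕ→ℚ n +ℚ r ≡ r * ℕ→ℚ (suc n)
*-ℕ→ℚ-suc r n = begin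
  r * ℕ→ℚ n +ℚ r            ≡⟨ cong (r * ℕ→ℚ n +ℚ_) (sym (*-identityʳ r)) ⟩
  r * ℕ→ℚ n +ℚ r * 1ℚ       ≡⟨ sym (*-distribˡ-+ r (ℕ→ℚ n) 1ℚ) ⟩
  r * (ℕ→ℚ n +ℚ ℕ→ℚ 1)      ≡⟨ cong (r *_) (sym (ℕ→ℚ-homo-+ n 1)) ⟩
  r * ℕ→ℚ (n + 1)          ≡⟨ cong (λ k → r * ℕ→ℚ k) (ℕ.+-comm n 1) ⟩
  r * ℕ→ℚ (suc n)          ∎
  where open ≡-Reasoning

0≤*-ℕ→ℚ : ∀ r .{{_ : NonNegative r}} n → 0ℚ ≤ℚ r * ℕ→ℚ n
0≤*-ℕ→ℚ r n = subst (_≤ℚ r * ℕ→ℚ n) (*-zeroʳ r) (*-monoˡ-≤-nonNeg r (ℕ→ℚ-mono-≤ {0} {n} z≤n))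

x∈p─q⇒x∉q : ∀ {n} {x : Fin n} (p q : Subset n) → x ∈ p ─ q → x ∉ q
x∈p─q⇒x∉q (_ ∷ p) (inside ∷ q)  (there x∈p─q) = x∈p─q⇒x∉q p q x∈p─q ∘ drop-there
x∈p─q⇒x∉q (_ ∷ p) (outside ∷ q) (there x∈p─q) = x∈p─q⇒x∉q p q x∈p─q ∘ drop-there
x∈p─q⇒x∉q (_ ∷ p) (outside ∷ q) here = λ ()

neighbours : ∀ {a b} → Multigraph a b → Fin a → Subset b
neighbours H u = tabulate λ v → 0 <ᵇ H u v

0<⇒∈neighbours : ∀ {a b} (H : Multigraph a b) {u v} → 0 < H u v → v ∈ neighbours H u
0<⇒∈neighbours H {u} {v} 0<Huv =
  lookup⇒[]= v _ (trans (lookup∘tabulate _ v) (Equivalence.to T-≡ (<⇒<ᵇ 0<Huv)))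

dropColumn : ∀ {a b} → Multigraph a (suc b) → Multigraph a b
dropColumn H u v = H u (suc v)

∣S∣≤∣S─neighbours∣+degIn : ∀ {a b} (H : Multigraph a b) S u →
  ∣ S ∣ ≤ ∣ S ─ neighbours H u ∣ + degIn H S u
∣S∣≤∣S─neighbours∣+degIn H [] u = z≤n
∣S∣≤∣S─neighbours∣+degIn H (x ∷ S) u with x | H u zero
... | outside | zero  = ∣S∣≤∣S─neighbours∣+degIn (dropColumn H) S u
... | outside | suc _ = ∣S∣≤∣S─neighbours∣+degIn (dropColumn H) S u
... | inside  | zero  = s≤s (∣S∣≤∣S─neighbours∣+degIn (dropColumn H) S u)
... | inside  | suc k = begin
  suc ∣ S ∣         ≤⟨ s≤s (∣S∣≤∣S─neighbours∣+degIn (dropColumn H) S u) ⟩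
  suc (s′ + d′)     ≡⟨ +-suc s′ d′ ⟨
  s′ + suc d′       ≤⟨ +-monoʳ-≤ s′ (s≤s (m≤n+m d′ k)) ⟩
  s′ + (suc k + d′) ∎
  where
  open ℕ.≤-Reasoning
  s′ = ∣ S ─ neighbours (dropColumn H) u ∣
  d′ = degIn (dropColumn H) S u

N[S]⊆T⇒N[S─neighbours]⊆T-u : ∀ {a b} (H : Multigraph a b) {S T} u →
  InNbhd H S ⊆ᵤ (_∈ T) → InNbhd H (S ─ neighbours H u) ⊆ᵤ (_∈ T - u)
N[S]⊆T⇒N[S─neighbours]⊆T-u H {S} {T} u N[S]⊆T {w} (v , v∈S─N[u] , 0<Hwv) =
  x∈p∧x≢y⇒x∈p-y (N[S]⊆T (v , p─q⊆p S (neighbours H u) v∈S─N[u] , 0<Hwv)) w≢u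
  where
  w≢u : w ≢ u
  w≢u refl = x∈p─q⇒x∉q S (neighbours H u) v∈S─N[u] (0<⇒∈neighbours H 0<Hwv)

module _ {a b} (H : Multigraph a b) (α : ℚ) .{{_ : NonNegative α}}
  (low-degree : (S : Subset b) → Nonempty S → ∃[ u ] (InNbhd H S u × ℕ→ℚ (degIn H S u) <ℚ α)) where

  mutual
    ∣S∣≤α∣T∣ : ∀ {T} → Acc (_<_ on ∣_∣) T → ∀ S → InNbhd H S ⊆ᵤ (_∈ T) →
      ℕ→ℚ ∣ S ∣ ≤ℚ α * ℕ→ℚ ∣ T ∣
    ∣S∣≤α∣T∣ {T} rec S N[S]⊆T with nonempty? S
    ... | yes S≢∅ = <⇒≤ (∣S∣<α∣T∣ rec S N[S]⊆T S≢∅)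
    ... | no  S≡∅ rewrite Empty-unique S≡∅ | ∣⊥∣≡0 b = 0≤*-ℕ→ℚ α ∣ T ∣

    ∣S∣<α∣T∣ : ∀ {T} → Acc (_<_ on ∣_∣) T → ∀ S → InNbhd H S ⊆ᵤ (_∈ T) → Nonempty S →
      ℕ→ℚ ∣ S ∣ <ℚ α * ℕ→ℚ ∣ T ∣
    ∣S∣<α∣T∣ {T} (acc smaller) S N[S]⊆T S≢∅ with low-degree S S≢∅
    ... | u , u∈N[S] , d<α = begin-strict
      ℕ→ℚ ∣ S ∣                    ≤⟨ ℕ→ℚ-mono-≤ (∣S∣≤∣S─neighbours∣+degIn H S u) ⟩
      ℕ→ℚ (∣ S′ ∣ + d)             ≡⟨ ℕ→ℚ-homo-+ ∣ S′ ∣ d ⟩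
      ℕ→ℚ ∣ S′ ∣ +ℚ ℕ→ℚ d          <⟨ +-mono-≤-< ∣S′∣≤α∣T-u∣ d<α ⟩
      α * ℕ→ℚ ∣ T - u ∣ +ℚ α       ≡⟨ *-ℕ→ℚ-suc α ∣ T - u ∣ ⟩
      α * ℕ→ℚ (suc ∣ T - u ∣)      ≤⟨ *-monoˡ-≤-nonNeg α (ℕ→ℚ-mono-≤ ∣T-u∣<∣T∣) ⟩
      α * ℕ→ℚ ∣ T ∣                ∎
      where
      open ≤-Reasoning
      S′ = S ─ neighbours H u
      d  = degIn H S u
      ∣T-u∣<∣T∣ : ∣ T - u ∣ < ∣ T ∣
      ∣T-u∣<∣T∣ = x∈p⇒∣p-x∣<∣p∣ (N[S]⊆T u∈N[S])
      ∣S′∣≤α∣T-u∣ : ℕ→ℚ ∣ S′ ∣ ≤ℚ α * ℕ→ℚ ∣ T - u ∣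
      ∣S′∣≤α∣T-u∣ = ∣S∣≤α∣T∣ (smaller ∣T-u∣<∣T∣) S′ (N[S]⊆T⇒N[S─neighbours]⊆T-u H u N[S]⊆T)

lemma4 : (a b : ℕ) → 0 < a → 0 < b → (H : Multigraph a b) → (α : ℚ) → 0ℚ <ℚ α →
    ((B' : Subset b) → Nonempty B' → ∃[ u ] (InNbhd H B' u × ℕ→ℚ (degIn H B' u) <ℚ α)) →
    ℕ→ℚ b <ℚ α * ℕ→ℚ a
lemma4 a b _ 0<b H α 0<α low-degree =
  subst₂ (λ m n → ℕ→ℚ m <ℚ α * ℕ→ℚ n) (∣⊤∣≡n b) (∣⊤∣≡n a)
    (∣S∣<α∣T∣ H α {{pos⇒nonNeg α {{positive 0<α}}}} low-degree
      (on-wellFounded ∣_∣ <-wellFounded ⊤) ⊤ (λ _ → ∈⊤) (fromℕ< 0<b , ∈⊤))
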